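{- For every finite connected outerplanar graph $G$, $c_H(G)\le 2$.
   Context: Hyperopic Cops and Robbers on a finite connected simple graph $G$: one player controls $k$ cops, the other a single robber. The cops first choose starting vertices (several cops may share a vertex), then the robber chooses a starting vertex; afterwards, in each round, each cop moves to an adjacent vertex or stays put, and then the robber moves to an adjacent vertex or stays put. The robber always knows the cops' positions. The robber is invisible to the cops exactly when the robber's vertex is adjacent to the vertex of every cop (a robber on the same vertex as a cop is visible); otherwise the cops see the robber's position. The cops win if after finitely many rounds some cop occupies the robber's vertex, and the cops' strategy must guarantee this with certainty (no chance allowed). The hyperopic cop number $c_H(G)$ is the minimum $k$ for which $k$ cops have a winning strategy. -}

module Defs where

open import Data.Nat using (ℕ; zero; suc; _<_)
open import Data.Fin using (Fin; toℕ)
open import Data.Bool using (Bool; true; false; not)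
open import Data.Maybe using (Maybe; just; nothing)
open import Data.List using (List; []; _∷_)
open import Data.Product using (Σ; ∃; _×_; _,_; proj₁; proj₂)
open import Data.Sum using (_⊎_)
open import Data.Bool.ListAction using (any)
open import Data.List.Base using (allFin)
open import Function.Definitions using (Injective)
open import Relation.Binary.PropositionalEquality using (_≡_)
open import Relation.Nullary using (¬_)

record Graph : Set where
  field
    n      : ℕ
    adj    : Fin n → Fin n → Bool
    sym    : ∀ u v → adj u v ≡ adj v u
    irrefl : ∀ v → adj v v ≡ false

open Graph public

Vertex : Graph → Set
Vertex G = Fin (n G)

Edge : (G : Graph) → Vertex G → Vertex G → Set
Edge G u v = adj G u v ≡ true

data Reach (G : Graph) : Vertex G → Vertex G → Set where
  here : ∀ {u} → Reach G u u
  step : ∀ {u v w} → Edge G u v → Reach G v w → Reach G u w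

Connected : Graph → Set
Connected G = Vertex G × (∀ u v → Reach G u v)

-- Outerplanar (combinatorial form): the vertices can be placed in
-- (distinct) positions around a circle so that no two edges, drawn as
-- chords, cross, i.e. no two edges have interleaving endpoints.
Outerplanar : Graph → Set
Outerplanar G =
  Σ (Vertex G → Fin (n G)) λ pos →
    Injective _≡_ _≡_ pos ×
    (∀ a b c d → Edge G a b → Edge G c d →
      ¬ (toℕ (pos a) < toℕ (pos c) ×
         toℕ (pos c) < toℕ (pos b) ×
         toℕ (pos b) < toℕ (pos d)))

Config : Graph → ℕ → Set
Config G k = Fin k → Vertex G

Step : (G : Graph) → Vertex G → Vertex G → Set
Step G u v = u ≡ v ⊎ Edge G u v

-- the robber at v is invisible iff v is adjacent to every cop;
-- it is visible iff some cop is NOT adjacent to v (in particular a cop on v)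
visible : {G : Graph} {k : ℕ} → Config G k → Vertex G → Bool
visible {G} {k} C v = any (λ i → not (adj G (C i) v)) (allFin k)

observe : {G : Graph} {k : ℕ} → Config G k → Vertex G → Maybe (Vertex G)
observe {G} {k} C v with visible {G} {k} C v
... | true  = just v
... | false = nothing

-- observation history, newest observation first
History : Graph → Set
History G = List (Maybe (Vertex G))

record CopStrategy (G : Graph) (k : ℕ) : Set where
  field
    start : Config G k
    next  : Config G k → History G → Config G k
    legal : ∀ C h i → Step G (C i) (next C h i)

open CopStrategy public

-- a robber trajectory: r 0 is the starting vertex, r (suc t) its position
-- after its move in round t+1
RobberWalk : Graph → Set
RobberWalk G = Σ (ℕ → Vertex G) λ r → ∀ t → Step G (r t) (r (suc t))

-- state before the cops' move in round t+1: cop placement at time t and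
-- the history of all observations made so far (observations are made in
-- every state: after the robber's placement/moves and after the cops' moves)
play : {G : Graph} {k : ℕ} → CopStrategy G k → (ℕ → Vertex G) → ℕ →
       Config G k × History G
play {G} {k} σ r zero = start σ , (observe {G} {k} (start σ) (r zero) ∷ [])
play {G} {k} σ r (suc t) =
  let C = proj₁ (play {G} {k} σ r t)
      h = proj₂ (play {G} {k} σ r t)
      C' = next σ C h
  in C' , (observe {G} {k} C' (r (suc t)) ∷ observe {G} {k} C' (r t) ∷ h)

copsAt : {G : Graph} {k : ℕ} → CopStrategy G k → (ℕ → Vertex G) → ℕ → Config G k
copsAt {G} {k} σ r t = proj₁ (play {G} {k} σ r t)

-- capture at some finite time: a cop is on the robber's vertex either
-- after the robber's placement/move at time t, or after the cops' move in
-- round t+1 (robber still at r t)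
Captures : {G : Graph} {k : ℕ} → CopStrategy G k → (ℕ → Vertex G) → Set
Captures {k = k} σ r =
  ∃ λ t → ∃ λ (i : Fin k) →
    copsAt σ r t i ≡ r t ⊎ copsAt σ r (suc t) i ≡ r t

CopsWin : Graph → ℕ → Set
CopsWin G k = Σ (CopStrategy G k) λ σ → (w : RobberWalk G) → Captures σ (proj₁ w)

-- c_H(G) ≤ m  (c_H is the least k with CopsWin G k)
HyperopicCopNumber≤ : Graph → ℕ → Set
HyperopicCopNumber≤ G m = ∃ λ k → k Data.Nat.≤ m × CopsWin G k

-- Draw the vertices on a circle in the order of the outerplanar embedding, so that no two edges
-- cross.  The cops maintain an arc of positions containing the robber, with both cops outside it
-- and every edge leaving the arc ending at a cop.  If only one cop has a neighbour in the arc, the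
-- other walks towards it along a shortest path.  Otherwise a cop steps onto a neighbour y in the
-- arc: the chord to y cuts the arc, and the robber stays confined to its side of y, provided the
-- cop leaves no edge behind into that side.  A visible robber not adjacent to a cop shows which
-- side to keep; by non-crossing, at most one cop has neighbours in the arc on both sides of it, so
-- the other can enter at its neighbour nearest to the robber.  An invisible robber is adjacent to
-- both cops: if they are apart it is their unique common neighbour in the arc, and if they share a
-- vertex it lies beyond their lowest neighbour.  So every round catches the robber, shrinks the
-- arc, or keeps the arc and brings the cops closer together.

module Submission where

open import Defs hiding (sym)
open import Data.Nat using (ℕ; zero; suc; _∸_; _≤_; _<_; z≤n; s≤s; _<?_)
open import Data.Nat.Properties
  using (≤-refl; ≤-antisym; ≤-totalPreorder; <-trans; <-irrefl; <-cmp; <⇒≱; ≮⇒≥; ≤-<-trans; <-≤-trans;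
         ≤∧≢⇒<; ∸-monoʳ-<; ∸-monoˡ-<; <⇒≤)
open import Data.Nat.Induction using (<-wellFounded)
open import Data.Fin using (Fin; zero; suc; toℕ; _≟_)
open import Data.Fin.Properties using (toℕ-injective; toℕ<n; any?)
open import Data.Bool using (true; false)
import Data.Bool as Bool
open import Data.Maybe using (Maybe; just; nothing)
open import Data.List using ([]; _∷_)
open import Data.Product using (∃; ∃₂; _×_; _,_; proj₁; proj₂; uncurry)
import Data.Product as Product
open import Data.Product.Relation.Binary.Lex.Strict using (×-Lex; ×-wellFounded)
open import Data.Sum using (_⊎_; inj₁; inj₂; [_,_])
import Data.Sum as Sum
open import Data.Unit using (⊤; tt)
open import Data.Empty using (⊥; ⊥-elim)
open import Function using (_∘_; id; case_of_)
open import Induction.WellFounded using (WellFounded; Acc; acc)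
open import Relation.Binary.Bundles using (TotalPreorder)
open import Relation.Binary.Core using (Rel)
import Relation.Binary.Construct.Flip.EqAndOrd as Flip
open import Relation.Binary.Definitions using (tri<; tri≈; tri>)
open import Relation.Binary.PropositionalEquality using (_≡_; _≢_; refl; sym; trans; cong; cong₂; cong-app; subst₂)
open import Relation.Nullary using (¬_; Dec; yes; no; contradiction)
open import Relation.Nullary.Decidable using (_×-dec_)
open import Relation.Unary using (Pred; Decidable)

least : ∀ {p} {P : Pred ℕ p} → Decidable P → ∀ {n} → P n → ∃ λ m → P m × ∀ {j} → P j → m ≤ j
least P? {zero} p₀ = zero , p₀ , λ _ → z≤n
least P? {suc n} pₙ with P? zero
... | yes p₀ = zero , p₀ , λ _ → z≤n
... | no ¬p₀ with least (P? ∘ suc) pₙ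
...   | m , pₘ , min = suc m , pₘ , λ { {zero} p₀ → contradiction p₀ ¬p₀ ; {suc j} pⱼ → s≤s (min pⱼ) }

module _ {c ℓ₁ ℓ₂} (O : TotalPreorder c ℓ₁ ℓ₂) where
  open TotalPreorder O using (Carrier; _≲_; total) renaming (refl to ≲-refl; trans to ≲-trans)

  optimum? : ∀ {m p} {P : Pred (Fin m) p} → Decidable P → (f : Fin m → Carrier) →
             (∃ λ i → P i × ∀ {j} → P j → f j ≲ f i) ⊎ (∀ i → ¬ P i)
  optimum? {zero} P? f = inj₂ λ ()
  optimum? {suc m} P? f with optimum? (P? ∘ suc) (f ∘ suc) | P? zero
  ... | inj₂ none | no ¬p₀ = inj₂ λ { zero → ¬p₀ ; (suc i) → none i }
  ... | inj₂ none | yes p₀ = inj₁ (zero , p₀ , λ { {zero} _ → ≲-refl ; {suc j} pⱼ → ⊥-elim (none j pⱼ) })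
  ... | inj₁ (i , pᵢ , opt) | no ¬p₀ =
    inj₁ (suc i , pᵢ , λ { {zero} p₀ → contradiction p₀ ¬p₀ ; {suc j} pⱼ → opt pⱼ })
  ... | inj₁ (i , pᵢ , opt) | yes p₀ with total (f zero) (f (suc i))
  ...   | inj₁ f₀≲fᵢ = inj₁ (suc i , pᵢ , λ { {zero} _ → f₀≲fᵢ ; {suc j} pⱼ → opt pⱼ })
  ...   | inj₂ fᵢ≲f₀ = inj₁ (zero , p₀ , λ { {zero} _ → ≲-refl ; {suc j} pⱼ → ≲-trans (opt pⱼ) fᵢ≲f₀ })

maximum? : ∀ {m p} {P : Pred (Fin m) p} → Decidable P → (f : Fin m → ℕ) →
           (∃ λ i → P i × ∀ {j} → P j → f j ≤ f i) ⊎ (∀ i → ¬ P i)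
maximum? = optimum? ≤-totalPreorder

minimum? : ∀ {m p} {P : Pred (Fin m) p} → Decidable P → (f : Fin m → ℕ) →
           (∃ λ i → P i × ∀ {j} → P j → f i ≤ f j) ⊎ (∀ i → ¬ P i)
minimum? = optimum? (Flip.totalPreorder ≤-totalPreorder)

module _ {a ℓ} {A : Set a} {_<_ : Rel A ℓ} (wf : WellFounded _<_) where

  descend : ∀ {i g} {Inv : ℕ → Set i} {Goal : Set g} (μ : ℕ → A) →
            (∀ t → Inv t → Goal ⊎ (Inv (suc t) × μ (suc t) < μ t)) → Inv 0 → Goal
  descend {Inv = Inv} {Goal} μ progress = go 0 (wf (μ 0))
    where
    go : ∀ t → Acc _<_ (μ t) → Inv t → Goal
    go t (acc rs) invₜ with progress t invₜ
    ... | inj₁ goal = goal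
    ... | inj₂ (invₜ₊₁ , μ<) = go (suc t) (rs μ<) invₜ₊₁

record MemoryStrategy (G : Graph) (k : ℕ) (M : Set) : Set where
  field
    placement     : Config G k
    initial       : M
    respond       : Config G k → M → Maybe (Vertex G) → Config G k × M
    respond-legal : ∀ C m o i → Step G (C i) (proj₁ (respond C m o) i)

module _ {G : Graph} {k : ℕ} {M : Set} (S : MemoryStrategy G k M) where
  open MemoryStrategy S

  latest : History G → Maybe (Vertex G)
  latest []      = nothing
  latest (o ∷ _) = o

  -- Each round appends two observations; the rule consults the one made after the robber's move.
  replay : History G → Config G k × M
  replay []          = placement , initial
  replay (_ ∷ [])    = placement , initial
  replay (_ ∷ _ ∷ h) = uncurry respond (replay h) (latest h)

  toCopStrategy : CopStrategy G k
  toCopStrategy = record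
    { start = placement
    ; next  = λ C h → proj₁ (respond C (proj₂ (replay h)) (latest h))
    ; legal = λ C h → respond-legal C (proj₂ (replay h)) (latest h)
    }

  run : (ℕ → Vertex G) → ℕ → Config G k × M
  run r zero    = placement , initial
  run r (suc t) = uncurry respond (run r t) (observe {G} (proj₁ (run r t)) (r t))

  module _ (r : ℕ → Vertex G) where
    private
      history : ℕ → History G
      history t = proj₂ (play toCopStrategy r t)

    latest-history : ∀ t → latest (history t) ≡ observe {G} (copsAt toCopStrategy r t) (r t)
    latest-history zero    = refl
    latest-history (suc t) = refl

    play-run : ∀ t → copsAt toCopStrategy r t ≡ proj₁ (run r t) × replay (history t) ≡ run r t
    play-run zero = refl , refl
    play-run (suc t) with play-run t
    ... | cops≡ , replay≡ rewrite latest-history t =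
      cong₂ (λ C m → proj₁ (respond C (proj₂ m) (observe {G} C (r t)))) cops≡ replay≡ ,
      cong₂ (λ C m → uncurry respond m (observe {G} C (r t))) cops≡ replay≡

module _ (G : Graph) where

  private
    variable
      a b c d p q u v w x y c₀ c₁ : Vertex G
      lo hi : ℕ
      o : Maybe (Vertex G)

  edge? : ∀ u v → Dec (Edge G u v)
  edge? u v = adj G u v Bool.≟ true

  edge-sym : Edge G u v → Edge G v u
  edge-sym {u} {v} e = trans (Graph.sym G v u) e

  walk-exits : ∀ {ℓ} {P : Pred (Vertex G) ℓ} → Decidable P → P u → ¬ P v → Reach G u v →
               ∃₂ λ a b → P a × ¬ P b × Edge G a b
  walk-exits P? pᵤ ¬pᵥ here = contradiction pᵤ ¬pᵥ
  walk-exits {u = u} P? pᵤ ¬pᵥ (step {v = m} e rest) with P? m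
  ... | yes pₘ  = walk-exits P? pₘ ¬pᵥ rest
  ... | no ¬pₘ = u , m , pᵤ , ¬pₘ , e

  data Sighting (c₀ c₁ x : Vertex G) : Maybe (Vertex G) → Set where
    hidden : Edge G c₀ x → Edge G c₁ x → Sighting c₀ c₁ x nothing
    seen   : ¬ (Edge G c₀ x × Edge G c₁ x) → Sighting c₀ c₁ x (just x)

  observe-sighting : ∀ (C : Config G 2) x → Sighting (C zero) (C (suc zero)) x (observe {G} C x)
  observe-sighting C x with adj G (C zero) x in e₀ | adj G (C (suc zero)) x in e₁
  ... | true  | true  = hidden e₀ e₁
  ... | true  | false = seen λ (_ , e) → case trans (sym e₁) e of λ ()
  ... | false | _     = seen λ (e , _) → case trans (sym e₀) e of λ ()

  Caught : Vertex G → Vertex G → Vertex G → Set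
  Caught c₀ c₁ x = c₀ ≡ x ⊎ c₁ ≡ x

  module Distance (reach : ∀ u v → Reach G u v) where

    Walk : ℕ → Vertex G → Vertex G → Set
    Walk zero    u v = u ≡ v
    Walk (suc k) u v = ∃ λ w → Edge G u w × Walk k w v

    walk? : ∀ k u v → Dec (Walk k u v)
    walk? zero    u v = u ≟ v
    walk? (suc k) u v = any? λ w → edge? u w ×-dec walk? k w v

    walk-snoc : ∀ k → Walk k u v → Edge G v w → Walk (suc k) u w
    walk-snoc zero    refl             e = _ , e , refl
    walk-snoc (suc k) (m , e′ , rest) e = m , e′ , walk-snoc k rest e

    walk-reverse : ∀ k → Walk k u v → Walk k v u
    walk-reverse zero    refl            = refl
    walk-reverse (suc k) (m , e , rest) = walk-snoc k (walk-reverse k rest) (edge-sym e)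

    reach⇒walk : Reach G u v → ∃ λ k → Walk k u v
    reach⇒walk here       = zero , refl
    reach⇒walk (step e r) = let k , walk = reach⇒walk r in suc k , _ , e , walk

    shortest : ∀ u v → ∃ λ k → Walk k u v × ∀ {j} → Walk j u v → k ≤ j
    shortest u v = least (λ k → walk? k u v) (proj₂ (reach⇒walk (reach u v)))

    dist : Vertex G → Vertex G → ℕ
    dist u v = proj₁ (shortest u v)

    dist-walk : ∀ u v → Walk (dist u v) u v
    dist-walk u v = proj₁ (proj₂ (shortest u v))

    dist-minimal : ∀ {j} → Walk j u v → dist u v ≤ j
    dist-minimal {u} {v} = proj₂ (proj₂ (shortest u v))

    dist-sym : ∀ u v → dist u v ≡ dist v u
    dist-sym u v = ≤-antisym (dist-minimal (walk-reverse _ (dist-walk v u)))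
                             (dist-minimal (walk-reverse _ (dist-walk u v)))

    towards : ∀ u v → ∃ λ w → Step G u w × (u ≢ v → dist w v < dist u v)
    towards u v with u ≟ v
    ... | yes u≡v = u , inj₁ refl , contradiction u≡v
    ... | no u≢v with dist u v | dist-walk u v
    ...   | zero  | u≡v           = contradiction u≡v u≢v
    ...   | suc k | w , e , walk = w , inj₂ e , λ _ → s≤s (dist-minimal walk)

  module _ (conn : Connected G) (outer : Outerplanar G) where
    open Distance (proj₂ conn)

    pos : Vertex G → ℕ
    pos v = toℕ (proj₁ outer v)

    pos-injective : pos u ≡ pos v → u ≡ v
    pos-injective = proj₁ (proj₂ outer) ∘ toℕ-injective

    pos-≤∧≢⇒< : pos u ≤ pos v → u ≢ v → pos u < pos v
    pos-≤∧≢⇒< u≤v u≢v = ≤∧≢⇒< u≤v (u≢v ∘ pos-injective)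

    no-crossing : Edge G a b → Edge G c d → pos a < pos c → pos c < pos b → pos b < pos d → ⊥
    no-crossing {a} {b} {c} {d} ab cd a<c c<b b<d = proj₂ (proj₂ outer) a b c d ab cd (a<c , c<b , b<d)

    Inside : ℕ → ℕ → Vertex G → Set
    Inside lo hi v = lo < pos v × pos v < hi

    inside? : ∀ lo hi → Decidable (Inside lo hi)
    inside? lo hi v = (lo <? pos v) ×-dec (pos v <? hi)

    outside : ¬ Inside lo hi p → pos p ≤ lo ⊎ hi ≤ pos p
    outside {lo} {hi} {p} p-out with lo <? pos p
    ... | no lo≮p = inj₁ (≮⇒≥ lo≮p)
    ... | yes lo<p = inj₂ (≮⇒≥ λ p<hi → p-out (lo<p , p<hi))

    chord-separates : ¬ Inside lo hi p → Edge G p y → lo < pos u → pos u < pos y → pos y < pos w → pos w < hi →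
                      ¬ Edge G u w
    chord-separates p-out p-y lo<u u<y y<w w<hi u-w with outside p-out
    ... | inj₁ p≤lo = no-crossing p-y u-w (≤-<-trans p≤lo lo<u) u<y y<w
    ... | inj₂ hi≤p = no-crossing u-w (edge-sym p-y) u<y y<w (<-≤-trans w<hi hi≤p)

    NeighbourIn : ℕ → ℕ → Vertex G → Pred (Vertex G) _
    NeighbourIn lo hi p w = Inside lo hi w × Edge G p w

    neighbourIn? : ∀ lo hi p → Decidable (NeighbourIn lo hi p)
    neighbourIn? lo hi p w = inside? lo hi w ×-dec edge? p w

    Attached : ℕ → ℕ → Vertex G → Set
    Attached lo hi p = ∃ (NeighbourIn lo hi p)

    attached? : ∀ lo hi p → Dec (Attached lo hi p)
    attached? lo hi p = any? (neighbourIn? lo hi p)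

    no-interleaving : p ≢ q → ¬ Inside lo hi p → ¬ Inside lo hi q →
                      NeighbourIn lo hi p a → NeighbourIn lo hi p b →
                      NeighbourIn lo hi q c → NeighbourIn lo hi q d →
                      pos a < pos d → pos c < pos b → ⊥
    no-interleaving {p} {q} p≢q p-out q-out ((lo<a , _) , pa) ((_ , b<hi) , pb)
                    ((lo<c , _) , qc) ((_ , d<hi) , qd) a<d c<b
      with outside p-out | outside q-out | <-cmp (pos p) (pos q)
    ... | _         | _         | tri≈ _ p≡q _ = p≢q (pos-injective p≡q)
    ... | inj₁ _    | inj₁ q≤lo | tri< p<q _ _ = no-crossing pa qd p<q (≤-<-trans q≤lo lo<a) a<d
    ... | inj₁ p≤lo | inj₁ _    | tri> _ _ q<p = no-crossing qc pb q<p (≤-<-trans p≤lo lo<c) c<b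
    ... | inj₁ p≤lo | inj₂ hi≤q | _            = no-crossing pb (edge-sym qc) (≤-<-trans p≤lo lo<c) c<b (<-≤-trans b<hi hi≤q)
    ... | inj₂ hi≤p | inj₁ q≤lo | _            = no-crossing qd (edge-sym pa) (≤-<-trans q≤lo lo<a) a<d (<-≤-trans d<hi hi≤p)
    ... | inj₂ hi≤p | inj₂ _    | tri< p<q _ _ = no-crossing (edge-sym pa) (edge-sym qd) a<d (<-≤-trans d<hi hi≤p) p<q
    ... | inj₂ _    | inj₂ hi≤q | tri> _ _ q<p = no-crossing (edge-sym qc) (edge-sym pb) c<b (<-≤-trans b<hi hi≤q) q<p

    common-neighbour-unique : p ≢ q → ¬ Inside lo hi p → ¬ Inside lo hi q →
                              NeighbourIn lo hi p x → NeighbourIn lo hi q x →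
                              NeighbourIn lo hi p y → NeighbourIn lo hi q y → x ≡ y
    common-neighbour-unique {x = x} {y = y} p≢q p-out q-out px qx py qy with <-cmp (pos x) (pos y)
    ... | tri≈ _ x≡y _ = pos-injective x≡y
    ... | tri< x<y _ _ = ⊥-elim (no-interleaving p≢q p-out q-out px py qx qy x<y x<y)
    ... | tri> _ _ y<x = ⊥-elim (no-interleaving p≢q p-out q-out py px qy qx y<x y<x)

    Straddles : ℕ → ℕ → Vertex G → Vertex G → Set
    Straddles lo hi p x = ∃₂ λ a b → NeighbourIn lo hi p a × NeighbourIn lo hi p b × pos a < pos x × pos x < pos b

    straddles-unique : p ≢ q → ¬ Inside lo hi p → ¬ Inside lo hi q →
                       Straddles lo hi p x → Straddles lo hi q x → ⊥
    straddles-unique p≢q p-out q-out (_ , _ , pa , pb , a<x , x<b) (_ , _ , qc , qd , c<x , x<d) =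
      no-interleaving p≢q p-out q-out pa pb qc qd (<-trans a<x x<d) (<-trans c<x x<b)

    record Confined (c₀ c₁ : Vertex G) (lo hi : ℕ) (x : Vertex G) : Set where
      field
        robber-inside : Inside lo hi x
        cop₀-outside  : ¬ Inside lo hi c₀
        cop₁-outside  : ¬ Inside lo hi c₁
        guarded       : ∀ {w u} → Inside lo hi w → ¬ Inside lo hi u → Edge G w u → u ≡ c₀ ⊎ u ≡ c₁

    open Confined

    confined-swap : Confined c₀ c₁ lo hi x → Confined c₁ c₀ lo hi x
    confined-swap conf = record
      { robber-inside = robber-inside conf
      ; cop₀-outside  = cop₁-outside conf
      ; cop₁-outside  = cop₀-outside conf
      ; guarded       = λ w-in u-out w-u → Sum.swap (guarded conf w-in u-out w-u)
      }

    some-cop-attached : Confined c₀ c₁ lo hi x → Attached lo hi c₀ ⊎ Attached lo hi c₁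
    some-cop-attached {c₀} {lo = lo} {hi} {x} conf
      with walk-exits (inside? lo hi) (robber-inside conf) (cop₀-outside conf) (proj₂ conn x c₀)
    ... | w , u , w-in , u-out , w-u with guarded conf w-in u-out w-u
    ...   | inj₁ refl = inj₁ (w , w-in , edge-sym w-u)
    ...   | inj₂ refl = inj₂ (w , w-in , edge-sym w-u)

    robber-moves : Confined c₀ c₁ lo hi x → Step G x y → Caught c₀ c₁ y ⊎ Confined c₀ c₁ lo hi y
    robber-moves conf (inj₁ refl) = inj₂ conf
    robber-moves {lo = lo} {hi} {y = y} conf (inj₂ x-y) with inside? lo hi y
    ... | yes y-in = inj₂ (record { Confined conf; robber-inside = y-in })
    ... | no y-out = inj₁ (Sum.map sym sym (guarded conf (robber-inside conf) y-out x-y))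

    confined-chase : ¬ Attached lo hi c₁ → Step G c₁ w → Confined c₀ c₁ lo hi x → Confined c₀ w lo hi x
    confined-chase ¬a₁ c₁-w conf = record
      { robber-inside = robber-inside conf
      ; cop₀-outside  = cop₀-outside conf
      ; cop₁-outside  = w-out c₁-w
      ; guarded       = λ v-in u-out v-u →
          Sum.map₂ (λ { refl → ⊥-elim (¬a₁ (_ , v-in , edge-sym v-u)) }) (guarded conf v-in u-out v-u)
      }
      where
      w-out : Step G _ w → ¬ Inside _ _ w
      w-out (inj₁ refl) = cop₁-outside conf
      w-out (inj₂ c₁-w) w-in = ¬a₁ (_ , w-in , c₁-w)

    -- The last hypothesis ensures that the vertex the cop leaves is no exit from the robber's side.
    confine-above : Confined c₀ c₁ lo hi x → NeighbourIn lo hi c₀ y → pos y < pos x →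
                    (c₀ ≡ c₁ ⊎ (∀ {w} → Inside (pos y) hi w → ¬ Edge G c₀ w)) → Confined y c₁ (pos y) hi x
    confine-above {c₀} {c₁} {lo} {hi} {y = y} conf ((lo<y , y<hi) , c₀-y) y<x guard = record
      { robber-inside = y<x , proj₂ (robber-inside conf)
      ; cop₀-outside  = λ (y<y , _) → <-irrefl refl y<y
      ; cop₁-outside  = λ (y<c₁ , c₁<hi) → cop₁-outside conf (<-trans lo<y y<c₁ , c₁<hi)
      ; guarded       = guarded′
      }
      where
      guarded′ : ∀ {w u} → Inside (pos y) hi w → ¬ Inside (pos y) hi u → Edge G w u → u ≡ y ⊎ u ≡ c₁
      guarded′ {w} {u} (y<w , w<hi) u-out w-u with inside? lo hi u
      ... | yes (lo<u , u<hi) with <-cmp (pos u) (pos y)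
      ...   | tri< u<y _ _ = ⊥-elim (chord-separates (cop₀-outside conf) c₀-y lo<u u<y y<w w<hi (edge-sym w-u))
      ...   | tri≈ _ u≡y _ = inj₁ (pos-injective u≡y)
      ...   | tri> _ _ y<u = ⊥-elim (u-out (y<u , u<hi))
      guarded′ (y<w , w<hi) u-out w-u | no u-out₀ with guarded conf (<-trans lo<y y<w , w<hi) u-out₀ w-u
      ... | inj₂ u≡c₁ = inj₂ u≡c₁
      ... | inj₁ refl = inj₂ ([ id , (λ none → ⊥-elim (none (y<w , w<hi) (edge-sym w-u))) ] guard)

    confine-below : Confined c₀ c₁ lo hi x → NeighbourIn lo hi c₀ y → pos x < pos y →
                    (c₀ ≡ c₁ ⊎ (∀ {w} → Inside lo (pos y) w → ¬ Edge G c₀ w)) → Confined y c₁ lo (pos y) x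
    confine-below {c₀} {c₁} {lo} {hi} {y = y} conf ((lo<y , y<hi) , c₀-y) x<y guard = record
      { robber-inside = proj₁ (robber-inside conf) , x<y
      ; cop₀-outside  = λ (_ , y<y) → <-irrefl refl y<y
      ; cop₁-outside  = λ (lo<c₁ , c₁<y) → cop₁-outside conf (lo<c₁ , <-trans c₁<y y<hi)
      ; guarded       = guarded′
      }
      where
      guarded′ : ∀ {w u} → Inside lo (pos y) w → ¬ Inside lo (pos y) u → Edge G w u → u ≡ y ⊎ u ≡ c₁
      guarded′ {w} {u} (lo<w , w<y) u-out w-u with inside? lo hi u
      ... | yes (lo<u , u<hi) with <-cmp (pos u) (pos y)
      ...   | tri< u<y _ _ = ⊥-elim (u-out (lo<u , u<y))
      ...   | tri≈ _ u≡y _ = inj₁ (pos-injective u≡y)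
      ...   | tri> _ _ y<u = ⊥-elim (chord-separates (cop₀-outside conf) c₀-y lo<w w<y y<u u<hi w-u)
      guarded′ (lo<w , w<y) u-out w-u | no u-out₀ with guarded conf (lo<w , <-trans w<y y<hi) u-out₀ w-u
      ... | inj₂ u≡c₁ = inj₂ u≡c₁
      ... | inj₁ refl = inj₂ ([ id , (λ none → ⊥-elim (none (lo<w , w<y) (edge-sym w-u))) ] guard)

    measure : Vertex G → Vertex G → ℕ → ℕ → ℕ × ℕ
    measure c₀ c₁ lo hi = hi ∸ lo , dist c₀ c₁

    _⊏_ : Rel (ℕ × ℕ) _
    _⊏_ = ×-Lex _≡_ _<_ _<_

    measure-swap : ∀ c₀ c₁ lo hi → measure c₀ c₁ lo hi ≡ measure c₁ c₀ lo hi
    measure-swap c₀ c₁ lo hi = cong (hi ∸ lo ,_) (dist-sym c₀ c₁)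

    record Response (c₀ c₁ : Vertex G) (lo hi : ℕ) (o : Maybe (Vertex G)) : Set where
      constructor response
      field
        c₀′ c₁′ : Vertex G
        lo′ hi′ : ℕ
        moves₀  : Step G c₀ c₀′
        moves₁  : Step G c₁ c₁′
        sound   : ∀ {x} → Confined c₀ c₁ lo hi x → Sighting c₀ c₁ x o →
                  Caught c₀′ c₁′ x ⊎ (Confined c₀′ c₁′ lo′ hi′ x × measure c₀′ c₁′ lo′ hi′ ⊏ measure c₀ c₁ lo hi)

    open Response

    sighting-swap : Sighting c₀ c₁ x o → Sighting c₁ c₀ x o
    sighting-swap (hidden c₀-x c₁-x) = hidden c₁-x c₀-x
    sighting-swap (seen ¬both)       = seen (¬both ∘ Product.swap)

    response-swap : Response c₁ c₀ lo hi o → Response c₀ c₁ lo hi o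
    response-swap {c₁ = c₁} {c₀ = c₀} {lo = lo} {hi = hi} (response c₁′ c₀′ lo′ hi′ moves₁ moves₀ sound) =
      response c₀′ c₁′ lo′ hi′ moves₀ moves₁ λ conf s →
        Sum.map Sum.swap
                (Product.map confined-swap (subst₂ _⊏_ (measure-swap c₁′ c₀′ lo′ hi′) (measure-swap c₁ c₀ lo hi)))
                (sound (confined-swap conf) (sighting-swap s))

    stay : (∀ {x} → Confined c₀ c₁ lo hi x → Sighting c₀ c₁ x o → ⊥) → Response c₀ c₁ lo hi o
    stay {lo = lo} {hi = hi} impossible =
      response _ _ lo hi (inj₁ refl) (inj₁ refl) λ conf s → ⊥-elim (impossible conf s)

    catch : Edge G c₀ y → (∀ {x} → Confined c₀ c₁ lo hi x → Sighting c₀ c₁ x o → y ≡ x) → Response c₀ c₁ lo hi o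
    catch {y = y} {c₁ = c₁} {lo = lo} {hi = hi} c₀-y hits =
      response y c₁ lo hi (inj₂ c₀-y) (inj₁ refl) λ conf s → inj₁ (inj₁ (hits conf s))

    chase : Attached lo hi c₀ → ¬ Attached lo hi c₁ → Response c₀ c₁ lo hi o
    chase {lo = lo} {hi = hi} {c₀ = c₀} {c₁ = c₁} a₀ ¬a₁ with towards c₁ c₀
    ... | c₁′ , c₁-c₁′ , closer =
      response c₀ c₁′ lo hi (inj₁ refl) c₁-c₁′ λ conf _ →
        inj₂ (confined-chase ¬a₁ c₁-c₁′ conf , inj₂ (refl , nearer))
      where
      nearer : dist c₀ c₁′ < dist c₀ c₁
      nearer = subst₂ _<_ (dist-sym c₁′ c₀) (dist-sym c₁ c₀) (closer λ { refl → ¬a₁ a₀ })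

    enter-above : NeighbourIn lo hi c₀ y → (c₀ ≡ c₁ ⊎ (∀ {w} → Inside (pos y) hi w → ¬ Edge G c₀ w)) →
                  (∀ {x} → Confined c₀ c₁ lo hi x → Sighting c₀ c₁ x o → y ≡ x ⊎ pos y < pos x) →
                  Response c₀ c₁ lo hi o
    enter-above {hi = hi} {y = y} {c₁ = c₁} y-nb@((lo<y , y<hi) , c₀-y) guard locate =
      response y c₁ (pos y) hi (inj₂ c₀-y) (inj₁ refl) λ conf s →
        Sum.map inj₁ (λ y<x → confine-above conf y-nb y<x guard , inj₁ (∸-monoʳ-< lo<y (<⇒≤ y<hi))) (locate conf s)

    enter-below : NeighbourIn lo hi c₀ y → (c₀ ≡ c₁ ⊎ (∀ {w} → Inside lo (pos y) w → ¬ Edge G c₀ w)) →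
                  (∀ {x} → Confined c₀ c₁ lo hi x → Sighting c₀ c₁ x o → y ≡ x ⊎ pos x < pos y) →
                  Response c₀ c₁ lo hi o
    enter-below {lo = lo} {y = y} {c₁ = c₁} y-nb@((lo<y , y<hi) , c₀-y) guard locate =
      response y c₁ lo (pos y) (inj₂ c₀-y) (inj₁ refl) λ conf s →
        Sum.map inj₁ (λ x<y → confine-below conf y-nb x<y guard , inj₁ (∸-monoˡ-< y<hi (<⇒≤ lo<y))) (locate conf s)

    data Entry (p : Vertex G) (lo hi : ℕ) (x : Vertex G) : Set where
      above : ∀ y → NeighbourIn lo hi p y → pos y < pos x → (∀ {w} → Inside (pos y) hi w → ¬ Edge G p w) →
              Entry p lo hi x
      below : ∀ y → NeighbourIn lo hi p y → pos x < pos y → (∀ {w} → Inside lo (pos y) w → ¬ Edge G p w) →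
              Entry p lo hi x

    entry? : Attached lo hi p → ¬ Edge G p x → Entry p lo hi x ⊎ Straddles lo hi p x
    entry? {lo} {hi} {p} {x} (w , w-nb) ¬p-x
      with maximum? (neighbourIn? lo hi p) pos | minimum? (neighbourIn? lo hi p) pos
    ... | inj₂ none | _         = contradiction w-nb (none w)
    ... | inj₁ _    | inj₂ none = contradiction w-nb (none w)
    ... | inj₁ (b , b-nb , b-max) | inj₁ (a , a-nb , a-min) with pos b <? pos x | pos x <? pos a
    ...   | yes b<x | _ = inj₁ (above b b-nb b<x λ (b<v , v<hi) p-v →
                            <⇒≱ b<v (b-max ((<-trans (proj₁ (proj₁ b-nb)) b<v , v<hi) , p-v)))
    ...   | no _ | yes x<a = inj₁ (below a a-nb x<a λ (lo<v , v<a) p-v →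
                               <⇒≱ v<a (a-min ((lo<v , <-trans v<a (proj₂ (proj₁ a-nb))) , p-v)))
    ...   | no b≮x | no x≮a = inj₂ (a , b , a-nb , b-nb ,
                                    pos-≤∧≢⇒< (≮⇒≥ x≮a) (λ { refl → ¬p-x (proj₂ a-nb) }) ,
                                    pos-≤∧≢⇒< (≮⇒≥ b≮x) (λ { refl → ¬p-x (proj₂ b-nb) }))

    enter : Entry c₀ lo hi x → Response c₀ c₁ lo hi (just x)
    enter (above y y-nb y<x guard) = enter-above y-nb (inj₂ guard) λ { _ (seen _) → inj₂ y<x }
    enter (below y y-nb x<y guard) = enter-below y-nb (inj₂ guard) λ { _ (seen _) → inj₂ x<y }

    together : ∀ o → Attached lo hi c₀ → Response c₀ c₀ lo hi o
    together {lo} {hi} {c₀} o (w , w-nb) with minimum? (neighbourIn? lo hi c₀) pos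
    ... | inj₂ none = contradiction w-nb (none w)
    together {lo} {hi} {c₀} nothing _ | inj₁ (y , y-nb , y-min) = enter-above y-nb (inj₁ refl) located
      where
      located : ∀ {x} → Confined c₀ c₀ lo hi x → Sighting c₀ c₀ x nothing → y ≡ x ⊎ pos y < pos x
      located {x} conf (hidden c₀-x _) with y ≟ x
      ... | yes y≡x = inj₁ y≡x
      ... | no y≢x  = inj₂ (pos-≤∧≢⇒< (y-min (robber-inside conf , c₀-x)) y≢x)
    together (just x) _ | inj₁ (y , y-nb , _) with pos y <? pos x
    ... | yes y<x = enter-above y-nb (inj₁ refl) λ { _ (seen _) → inj₂ y<x }
    ... | no y≮x  = enter-below y-nb (inj₁ refl) λ { _ (seen ¬both) →
                      inj₂ (pos-≤∧≢⇒< (≮⇒≥ y≮x) λ { refl → ¬both (proj₂ y-nb , proj₂ y-nb) }) }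

    apart : c₀ ≢ c₁ → Attached lo hi c₀ → Attached lo hi c₁ → ∀ o → Response c₀ c₁ lo hi o
    apart {c₀} {c₁} {lo} {hi} c₀≢c₁ _ _ nothing with any? (λ w → neighbourIn? lo hi c₀ w ×-dec edge? c₁ w)
    ... | yes (w , w-nb , c₁-w) = catch (proj₂ w-nb) λ { conf (hidden c₀-x c₁-x) →
            common-neighbour-unique c₀≢c₁ (cop₀-outside conf) (cop₁-outside conf)
              w-nb (proj₁ w-nb , c₁-w) (robber-inside conf , c₀-x) (robber-inside conf , c₁-x) }
    ... | no none = stay λ { conf (hidden c₀-x c₁-x) → none (_ , (robber-inside conf , c₀-x) , c₁-x) }
    apart {c₀} {c₁} c₀≢c₁ a₀ a₁ (just x) with edge? c₀ x | edge? c₁ x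
    ... | yes c₀-x | _        = catch c₀-x λ { _ (seen _) → refl }
    ... | no _     | yes c₁-x = response-swap (catch c₁-x λ { _ (seen _) → refl })
    ... | no ¬c₀-x | no ¬c₁-x with entry? a₀ ¬c₀-x | entry? a₁ ¬c₁-x
    ...   | inj₁ e₀ | _       = enter e₀
    ...   | inj₂ _  | inj₁ e₁ = response-swap (enter e₁)
    ...   | inj₂ s₀ | inj₂ s₁ = stay λ { conf (seen _) →
              straddles-unique c₀≢c₁ (cop₀-outside conf) (cop₁-outside conf) s₀ s₁ }

    decide : ∀ c₀ c₁ lo hi o → Response c₀ c₁ lo hi o
    decide c₀ c₁ lo hi o with attached? lo hi c₀ | attached? lo hi c₁
    ... | yes a₀ | no ¬a₁  = chase a₀ ¬a₁
    ... | no ¬a₀ | yes a₁  = response-swap (chase a₁ ¬a₀)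
    ... | no ¬a₀ | no ¬a₁  = stay λ conf _ → [ ¬a₀ , ¬a₁ ] (some-cop-attached conf)
    ... | yes a₀ | yes a₁ with c₀ ≟ c₁
    ...   | yes refl  = together o a₀
    ...   | no c₀≢c₁ = apart c₀≢c₁ a₀ a₁ o

    leftmost : ∃ λ v₀ → ∀ w → pos v₀ ≤ pos w
    leftmost with minimum? {P = λ _ → ⊤} (λ _ → yes tt) pos
    ... | inj₁ (v₀ , _ , v₀-min) = v₀ , λ w → v₀-min tt
    ... | inj₂ none              = contradiction tt (none (proj₁ conn))

    v₀ : Vertex G
    v₀ = proj₁ leftmost

    inside-unless-v₀ : u ≢ v₀ → Inside (pos v₀) (n G) u
    inside-unless-v₀ {u} u≢v₀ = pos-≤∧≢⇒< (proj₂ leftmost u) (u≢v₀ ∘ sym) , toℕ<n (proj₁ outer u)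

    initially-confined : x ≢ v₀ → Confined v₀ v₀ (pos v₀) (n G) x
    initially-confined x≢v₀ = record
      { robber-inside = inside-unless-v₀ x≢v₀
      ; cop₀-outside  = v₀-outside
      ; cop₁-outside  = v₀-outside
      ; guarded       = λ {_} {u} _ u-out _ → inj₁ (outside-is-v₀ u u-out)
      }
      where
      v₀-outside : ¬ Inside (pos v₀) (n G) v₀
      v₀-outside (v₀<v₀ , _) = <-irrefl refl v₀<v₀

      outside-is-v₀ : ∀ u → ¬ Inside (pos v₀) (n G) u → u ≡ v₀
      outside-is-v₀ u u-out with u ≟ v₀
      ... | yes u≡v₀ = u≡v₀
      ... | no u≢v₀  = contradiction (inside-unless-v₀ u≢v₀) u-out

    pair : Vertex G → Vertex G → Config G 2
    pair c₀ c₁ zero       = c₀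
    pair c₀ c₁ (suc zero) = c₁

    respond : Config G 2 → ℕ × ℕ → Maybe (Vertex G) → Config G 2 × (ℕ × ℕ)
    respond C (lo , hi) o = pair (c₀′ R) (c₁′ R) , lo′ R , hi′ R
      where R = decide (C zero) (C (suc zero)) lo hi o

    respond-legal : ∀ C m o i → Step G (C i) (proj₁ (respond C m o) i)
    respond-legal C (lo , hi) o zero       = moves₀ (decide (C zero) (C (suc zero)) lo hi o)
    respond-legal C (lo , hi) o (suc zero) = moves₁ (decide (C zero) (C (suc zero)) lo hi o)

    rule : MemoryStrategy G 2 (ℕ × ℕ)
    rule = record
      { placement     = pair v₀ v₀
      ; initial       = pos v₀ , n G
      ; respond       = respond
      ; respond-legal = respond-legal
      }

    module _ (r : ℕ → Vertex G) (r-steps : ∀ t → Step G (r t) (r (suc t))) where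
      private
        σ : CopStrategy G 2
        σ = toCopStrategy rule

        cops : ℕ → Config G 2
        cops t = proj₁ (run rule r t)

        Trapped : ℕ → Set
        Trapped t = let lo , hi = proj₂ (run rule r t) in Confined (cops t zero) (cops t (suc zero)) lo hi (r t)

        μ : ℕ → ℕ × ℕ
        μ t = let lo , hi = proj₂ (run rule r t) in measure (cops t zero) (cops t (suc zero)) lo hi

      cop-on : ∀ t → Caught (cops t zero) (cops t (suc zero)) x → ∃ λ i → copsAt σ r t i ≡ x
      cop-on t (inj₁ e) = zero     , trans (cong-app (proj₁ (play-run rule r t)) zero) e
      cop-on t (inj₂ e) = suc zero , trans (cong-app (proj₁ (play-run rule r t)) (suc zero)) e

      round : ∀ t → Trapped t → Captures σ r ⊎ (Trapped (suc t) × μ (suc t) ⊏ μ t)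
      round t trapped with sound (decide _ _ _ _ _) trapped (observe-sighting (cops t) (r t))
      ... | inj₁ caught = inj₁ (t , Product.map₂ inj₂ (cop-on (suc t) caught))
      ... | inj₂ (conf , μ<) with robber-moves conf (r-steps t)
      ...   | inj₁ caught = inj₁ (suc t , Product.map₂ inj₁ (cop-on (suc t) caught))
      ...   | inj₂ conf′  = inj₂ (conf′ , μ<)

      captured : Captures σ r
      captured with r 0 ≟ v₀
      ... | yes r₀≡v₀ = 0 , Product.map₂ inj₁ (cop-on 0 (inj₁ (sym r₀≡v₀)))
      ... | no r₀≢v₀  = descend (×-wellFounded <-wellFounded <-wellFounded) μ round (initially-confined r₀≢v₀)

    two-cops-win : CopsWin G 2
    two-cops-win = toCopStrategy rule , λ (r , r-steps) → captured r r-steps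

mainTheorem16 : (G : Graph) → Connected G → Outerplanar G → HyperopicCopNumber≤ G 2
mainTheorem16 G conn outer = 2 , ≤-refl , two-cops-win G conn outer
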